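{- Let $G$ be a graph and let $B,k,s$ be positive integers. Run $\mathrm{ExponentiateAndLocalPrune}(G,B,k,s)$. Then for every $v\in V(G)$ and every $i\in\{0,1,\dots,s\}$, the tree $T^{(i)}_v$ has at most $B$ nodes.
   Context: $\mathrm{LocalPrune}(T,k)$, for a rooted tree $T$ with root $r$: if $r$ has at most $k$ children, return the single-node tree $\{r\}$; otherwise for each child $c$ compute $\mathrm{LocalPrune}(T_c,k)$ ($T_c$ the subtree rooted at $c$), discard the $k$ largest of these (by node count, ties arbitrary), and return $r$ with the remaining pruned subtrees as child subtrees; mappings to $V(G)$ are restricted to the surviving nodes. $\mathrm{ExponentiateAndLocalPrune}(G,B,k,s)$: Initialization: for each $v$ with $|N_G(v)|<B$, $T^{(0)}_v$ is a root mapped to $v$ with one child mapped to each neighbor of $v$, and $v$ is marked active; for each $v$ with $|N_G(v)|\ge B$, $T^{(0)}_v$ is a single node mapped to $v$ and $v$ is marked inactive. For $i=1,\dots,s$: (Prune step) for every $v$, $T^{(i-1)}_{v,\mathrm{pruned}}=\mathrm{LocalPrune}(T^{(i-1)}_v,k)$ with restricted mapping; if $|V(T^{(i-1)}_{v,\mathrm{pruned}})|>\sqrt B$, mark $v$ inactive (inactive vertices stay inactive). (Attachment step, after pruning all $v$) for every $v$: if $v$ is inactive, $T^{(i)}_v=T^{(i-1)}_{v,\mathrm{pruned}}$; otherwise let $x_1,\dots,x_\eta$ be the leaves of $T^{(i-1)}_{v,\mathrm{pruned}}$ at distance exactly $2^{i-1}$ from the root that map to an active vertex, and replace each $x_j$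 by a fresh copy of $T^{(i-1)}_{u_j,\mathrm{pruned}}$, where $u_j$ is the image of $x_j$ (the copy's root takes the place of $x_j$), with the mapping inherited from the pieces. -}

module Defs where

open import Data.Nat using (ℕ; zero; suc; _+_; _*_; _∸_; _^_; _≤_; _<_)
open import Data.Nat.Properties using (_≤?_)
open import Data.Bool using (Bool; true; false; if_then_else_; _∧_; not)
open import Data.Fin using (Fin)
open import Data.List using (List; []; _∷_; length; map; allFin)
open import Data.List.Membership.Propositional using (_∈_)
open import Data.List.Relation.Binary.Pointwise using (Pointwise)
open import Data.Product using (Σ; _×_; _,_; proj₁; proj₂)
open import Relation.Binary.PropositionalEquality using (_≡_)
open import Relation.Nullary.Decidable using (⌊_⌋)

record Graph : Set where
  field
    n     : ℕ
    adj   : Fin n → Fin n → Bool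
    sym   : ∀ u v → adj u v ≡ adj v u
    irrefl : ∀ v → adj v v ≡ false

neighbours : (G : Graph) → Fin (Graph.n G) → List (Fin (Graph.n G))
neighbours G v = go (allFin (Graph.n G))
  where
  go : List (Fin (Graph.n G)) → List (Fin (Graph.n G))
  go []       = []
  go (u ∷ us) = if Graph.adj G v u then u ∷ go us else go us

-- Rooted trees whose nodes are mapped to elements of A
-- (node a cs : a root mapped to a, with ordered child subtrees cs)

data Tree (A : Set) : Set where
  node : A → List (Tree A) → Tree A

label : ∀ {A} → Tree A → A
label (node a _) = a

mutual
  size : ∀ {A} → Tree A → ℕ
  size (node _ cs) = suc (sizes cs)

  sizes : ∀ {A} → List (Tree A) → ℕ
  sizes []       = 0
  sizes (t ∷ ts) = size t + sizes ts

-- LocalPrune(T,k) as a relation (ties among the k largest are broken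
-- arbitrarily, so every admissible choice is allowed).
-- A selection marks each pruned child subtree with a Bool:
-- true = discarded, false = kept.

discarded : ∀ {A} → List (Bool × Tree A) → ℕ
discarded []                 = 0
discarded ((true  , _) ∷ xs) = suc (discarded xs)
discarded ((false , _) ∷ xs) = discarded xs

kept : ∀ {A} → List (Bool × Tree A) → List (Tree A)
kept []                 = []
kept ((true  , _) ∷ xs) = kept xs
kept ((false , t) ∷ xs) = t ∷ kept xs

data LocalPrune {A : Set} (k : ℕ) : Tree A → Tree A → Set where
  few  : ∀ {r cs} → length cs ≤ k →
         LocalPrune k (node r cs) (node r [])
  many : ∀ {r cs ps} → k < length cs →
         Pointwise (LocalPrune k) cs ps →
         (sel : List (Bool × Tree A)) →
         map proj₂ sel ≡ ps →
         discarded sel ≡ k →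
         (∀ t u → (true , t) ∈ sel → (false , u) ∈ sel → size u ≤ size t) →
         LocalPrune k (node r cs) (node r (kept sel))

mutual
  attach : ∀ {A} → ℕ → (A → Bool) → (A → Tree A) → Tree A → Tree A
  attach zero    act P (node u []) = if act u then P u else node u []
  attach zero    act P (node u (c ∷ cs)) = node u (c ∷ cs)
  attach (suc d) act P (node u cs) = node u (attachs d act P cs)

  attachs : ∀ {A} → ℕ → (A → Bool) → (A → Tree A) → List (Tree A) → List (Tree A)
  attachs d act P []       = []
  attachs d act P (t ∷ ts) = attach d act P t ∷ attachs d act P ts

module _ (G : Graph) (B k : ℕ) where
  open Graph G

  Config : Set
  Config = (Fin n → Tree (Fin n)) × (Fin n → Bool)

  initial : Config
  initial = T0 , act0
    where
    act0 : Fin n → Bool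
    act0 v = ⌊ suc (length (neighbours G v)) ≤? B ⌋
    T0 : Fin n → Tree (Fin n)
    T0 v = if act0 v then node v (map (λ u → node u []) (neighbours G v))
                     else node v []

  -- |V(T)| > √B  ⇔  |V(T)|² > B  (for natural |V(T)|)
  tooBig : Tree (Fin n) → Bool
  tooBig t = ⌊ suc B ≤? size t * size t ⌋

  -- iteration i (i ≥ 1): prune step, then attachment step
  data Step (i : ℕ) : Config → Config → Set where
    step : ∀ {T act} (P : Fin n → Tree (Fin n)) →
           (∀ v → LocalPrune k (T v) (P v)) →
           let act′ : Fin n → Bool
               act′ v = act v ∧ not (tooBig (P v))
           in Step i (T , act)
                     ((λ v → if act′ v then attach (2 ^ (i ∸ 1)) act′ P (P v)
                                      else P v) , act′)

  data Reach : ℕ → Config → Set where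
    start : Reach 0 initial
    next  : ∀ {i c c′} → Reach i c → Step (suc i) c c′ → Reach (suc i) c′

module Submission where

open import Defs
open import Data.Bool using (Bool; true; false; if_then_else_; _∧_; not)
open import Data.Fin using (Fin)
open import Data.List using (List; []; _∷_; length; map)
open import Data.List.Relation.Binary.Pointwise using (Pointwise; []; _∷_)
open import Data.Nat using (ℕ; zero; suc; _+_; _*_; _^_; _∸_; _≤_; z≤n; s≤s; NonZero; >-nonZero)
open import Data.Nat.DivMod using (_/_; /-monoˡ-≤; m*n/n≡m; m/n*n≤m; m≥n⇒m/n>0)
open import Data.Nat.Properties
open import Data.Product using (_×_; _,_; proj₁; proj₂)
open import Data.Sum using (inj₁; inj₂)
open import Relation.Binary.PropositionalEquality using (_≡_; refl; sym; cong; subst)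
open import Relation.Nullary using (yes; no)

-- A vertex stays active only while its pruned tree P v has p nodes with p² ≤ B, so
-- every tree attached to it has at most ⌊B/p⌋ nodes (its own square is also ≤ B).
-- Attaching trees of at most M nodes to the leaves of a tree multiplies its size by
-- at most M, hence T v has at most p ⌊B/p⌋ ≤ B nodes; pruning never adds nodes.

sizes-kept : ∀ {A : Set} (sel : List (Bool × Tree A)) → sizes (kept sel) ≤ sizes (map proj₂ sel)
sizes-kept []                = z≤n
sizes-kept ((true  , t) ∷ s) = ≤-trans (sizes-kept s) (m≤n+m _ (size t))
sizes-kept ((false , t) ∷ s) = +-monoʳ-≤ (size t) (sizes-kept s)

mutual
  size-localPrune : ∀ {A : Set} {k} {t p : Tree A} → LocalPrune k t p → size p ≤ size t
  size-localPrune (few _)                    = s≤s z≤n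
  size-localPrune (many _ ps sel refl _ _) = s≤s (≤-trans (sizes-kept sel) (sizes-localPrune ps))

  sizes-localPrune : ∀ {A : Set} {k} {ts ps : List (Tree A)} →
                     Pointwise (LocalPrune k) ts ps → sizes ps ≤ sizes ts
  sizes-localPrune []       = z≤n
  sizes-localPrune (p ∷ ps) = +-mono-≤ (size-localPrune p) (sizes-localPrune ps)

module _ {A : Set} (act : A → Bool) (P : A → Tree A) {M : ℕ} (1≤M : 1 ≤ M)
         (P≤M : ∀ u → act u ≡ true → size (P u) ≤ M) where

  mutual
    size-attach : ∀ d t → size (attach d act P t) ≤ size t * M
    size-attach zero (node u []) with act u in eq
    ... | true  = subst (size (P u) ≤_) (sym (+-identityʳ M)) (P≤M u eq)
    ... | false = subst (1 ≤_) (sym (+-identityʳ M)) 1≤M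
    size-attach zero t@(node u (_ ∷ _)) = m≤m*n (size t) M {{>-nonZero 1≤M}}
    size-attach (suc d) (node u ts) = +-mono-≤ 1≤M (sizes-attachs d ts)

    sizes-attachs : ∀ d ts → sizes (attachs d act P ts) ≤ sizes ts * M
    sizes-attachs d []       = z≤n
    sizes-attachs d (t ∷ ts) = begin
      size (attach d act P t) + sizes (attachs d act P ts) ≤⟨ +-mono-≤ (size-attach d t) (sizes-attachs d ts) ⟩
      size t * M + sizes ts * M                             ≡⟨ *-distribʳ-+ M (size t) (sizes ts) ⟨
      (size t + sizes ts) * M                               ∎
      where open ≤-Reasoning

m*n≤o⇒m≤o/n : ∀ {m n o} .{{_ : NonZero n}} → m * n ≤ o → m ≤ o / n
m*n≤o⇒m≤o/n {m} {n} {o} m*n≤o = begin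
  m         ≡⟨ m*n/n≡m m n ⟨
  m * n / n ≤⟨ /-monoˡ-≤ n m*n≤o ⟩
  o / n     ∎
  where open ≤-Reasoning

m*m≤o⇒n*n≤o⇒n*m≤o : ∀ m n {o} → m * m ≤ o → n * n ≤ o → n * m ≤ o
m*m≤o⇒n*n≤o⇒n*m≤o m n m*m≤o n*n≤o with ≤-total m n
... | inj₁ m≤n = ≤-trans (*-monoʳ-≤ n m≤n) n*n≤o
... | inj₂ n≤m = ≤-trans (*-monoˡ-≤ m n≤m) m*m≤o

size-positive : ∀ {A : Set} (t : Tree A) → 1 ≤ size t
size-positive (node _ _) = s≤s z≤n

module _ {A : Set} {B : ℕ} (act : A → Bool) (P : A → Tree A)
         (P≤B : ∀ u → size (P u) ≤ B)
         (active⇒P²≤B : ∀ u → act u ≡ true → size (P u) * size (P u) ≤ B) where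

  size-attachActive : ∀ d v → size (if act v then attach d act P (P v) else P v) ≤ B
  size-attachActive d v with act v in eq
  ... | false = P≤B v
  ... | true  = begin
    size (attach d act P (P v)) ≤⟨ size-attach act P 1≤B/p P≤B/p d (P v) ⟩
    p * (B / p)                 ≡⟨ *-comm p (B / p) ⟩
    B / p * p                   ≤⟨ m/n*n≤m B p ⟩
    B                           ∎
    where
    open ≤-Reasoning
    p = size (P v)
    instance p≢0 : NonZero p
    p≢0 = >-nonZero (size-positive (P v))
    1≤B/p : 1 ≤ B / p
    1≤B/p = m≥n⇒m/n>0 (≤-trans (m≤m*n p p) (active⇒P²≤B v eq))
    P≤B/p : ∀ u → act u ≡ true → size (P u) ≤ B / p
    P≤B/p u act-u = m*n≤o⇒m≤o/n (m*m≤o⇒n*n≤o⇒n*m≤o p (size (P u)) (active⇒P²≤B v eq) (active⇒P²≤B u act-u))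

sizes-leaves : ∀ {A : Set} (xs : List A) → sizes (map (λ u → node u []) xs) ≡ length xs
sizes-leaves []       = refl
sizes-leaves (_ ∷ xs) = cong suc (sizes-leaves xs)

module _ (G : Graph) (B k : ℕ) where
  open Graph G using (n)

  size-initial : 1 ≤ B → ∀ v → size (proj₁ (initial G B k) v) ≤ B
  size-initial 1≤B v with suc (length (neighbours G v)) ≤? B
  ... | yes deg<B = subst (_≤ B) (cong suc (sym (sizes-leaves (neighbours G v)))) deg<B
  ... | no  _     = 1≤B

  stillActive⇒size²≤B : ∀ b t → (b ∧ not (tooBig G B k t)) ≡ true → size t * size t ≤ B
  stillActive⇒size²≤B true t eq with suc B ≤? size t * size t
  ... | no B≮size² = ≮⇒≥ B≮size²

  size-reachable : 1 ≤ B → ∀ {i c} → Reach G B k i c → ∀ v → size (proj₁ c v) ≤ B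
  size-reachable 1≤B start = size-initial 1≤B
  size-reachable 1≤B {suc i} (next {c = _ , act} r (step P prune)) =
    size-attachActive act′ P P≤B
      (λ u act′-u → stillActive⇒size²≤B (act u) (P u) act′-u) (2 ^ (suc i ∸ 1))
    where
    act′ : Fin n → Bool
    act′ v = act v ∧ not (tooBig G B k (P v))
    P≤B : ∀ u → size (P u) ≤ B
    P≤B u = ≤-trans (size-localPrune (prune u)) (size-reachable 1≤B r u)

mainTheorem7 : (G : Graph) (B k s : ℕ) → 1 ≤ B → 1 ≤ k → 1 ≤ s →
    ∀ (i : ℕ) → i ≤ s → ∀ c → Reach G B k i c →
    ∀ (v : Fin (Graph.n G)) → size (proj₁ c v) ≤ B
mainTheorem7 G B k s 1≤B _ _ i _ c = size-reachable G B k 1≤B
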